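{- Let $d\ge 2$ and $1\le \ell\le d-1$, and let $G=(V,E)$ be a $\binom{d}{\ell}$-partite, $\binom{d}{\ell}$-uniform hypergraph whose parts are labeled by the $\ell$-element subsets of $[d]$, i.e. $V=\bigcup_{I\in\binom{[d]}{\ell}} V_I$. If $G$ is vertex-separable, then $G$ is edge-separable.
   Context: Every hyperedge contains exactly one vertex of each part $V_I$. For vertices $s,t$, an $s$--$t$ path is a sequence of vertices $s=v_1,\dots,v_r=t$ such that for each $i\in[r-1]$ the vertices $v_i,v_{i+1}$ lie in a common hyperedge; for hyperedges $e,e'$, an $e$--$e'$ path is a $v$--$v'$ path with $v\in e$, $v'\in e'$. For $j\in[d]$, call the parts $V_J$ with $j\in J$ (there are $\binom{d-1}{\ell-1}$ of them) the parts containing coordinate $j$. Two distinct vertices $v,v'$ of the same part $V_I$ are separable if there exists $j\in[d]\setminus I$ such that every $v$--$v'$ path contains a vertex lying in some part $V_J$ with $j\in J$; $G$ is vertex-separable if every two distinct vertices from the same part are separable. Two distinct hyperedges $e,e'$ are separable if there exists $j\in[d]$ such that every $e$--$e'$ path contains a vertex lying in some part $V_J$ with $j\in J$; $G$ is edge-separable if every two distinct hyperedges are separable. -}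

module Defs where

open import Data.Nat using (ℕ)
open import Data.Fin using (Fin)
open import Data.Fin.Subset using (Subset; _∈_; _∉_; ∣_∣)
open import Data.Product using (Σ; _×_; _,_; proj₁; proj₂; ∃; ∃-syntax)
open import Relation.Binary.PropositionalEquality using (_≡_)
open import Relation.Nullary using (¬_)
open import Data.Sum using (_⊎_)

Part : ℕ → ℕ → Set
Part d ℓ = Σ (Subset d) (λ I → ∣ I ∣ ≡ ℓ)

-- A hyperedge contains exactly
-- one vertex of each part, so it is a choice function
-- (I : Part d ℓ) → Fin (n I); the hyperedge set E is a set of such functions.
record Hypergraph (d ℓ : ℕ) : Set₁ where
  field
    n : Part d ℓ → ℕ
  Edge : Set
  Edge = (I : Part d ℓ) → Fin (n I)
  field
    E : Edge → Set

  Vertex : Set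
  Vertex = Σ (Part d ℓ) (λ I → Fin (n I))

  _∈ₑ_ : Vertex → Edge → Set
  v ∈ₑ e = e (proj₁ v) ≡ proj₂ v

  Adj : Vertex → Vertex → Set
  Adj v w = Σ Edge (λ e → E e × (v ∈ₑ e) × (w ∈ₑ e))

  data Path : Vertex → Vertex → Set where
    [_]  : (v : Vertex) → Path v v
    _∷_ : {u v w : Vertex} → Adj u v → Path v w → Path u w

  Hits : {s t : Vertex} → Fin d → Path s t → Set
  Hits j [ v ] = j ∈ proj₁ (proj₁ v)
  Hits j (_∷_ {u} a p) = (j ∈ proj₁ (proj₁ u)) ⊎ Hits j p

  VerticesSeparable : (I : Part d ℓ) → Fin (n I) → Fin (n I) → Set
  VerticesSeparable I x x' =
    ∃[ j ] (j ∉ proj₁ I × ((p : Path (I , x) (I , x')) → Hits j p))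

  VertexSeparable : Set
  VertexSeparable = (I : Part d ℓ) (x x' : Fin (n I)) → ¬ (x ≡ x') →
    VerticesSeparable I x x'

  EdgesSeparable : Edge → Edge → Set
  EdgesSeparable e e' = ∃[ j ] ((v v' : Vertex) → v ∈ₑ e → v' ∈ₑ e' →
    (p : Path v v') → Hits j p)

  -- distinct hyperedges (differ in some part; stated pointwise)
  EdgeSeparable : Set
  EdgeSeparable = (e e' : Edge) → E e → E e' → ¬ ((I : Part d ℓ) → e I ≡ e' I) →
    EdgesSeparable e e'

-- Two distinct hyperedges e, e' differ in some part V_I.  If j ∉ I separates
-- e I from e' I, then j separates e from e': any path from a vertex of e to a
-- vertex of e' extends, through the hyperedges e and e', to a path from e I to
-- e' I, whose new endpoints lie in V_I and therefore do not meet coordinate j.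
module Submission where

open import Defs
open import Data.Nat using (ℕ; _≤_; _∸_)
open import Data.Nat.Properties using (≡-irrelevant) renaming (_≟_ to _≟ℕ_)
open import Data.Fin.Properties using (_≟_)
open import Data.Fin.Subset using (Subset; ∣_∣; _∈_)
open import Data.Fin.Subset.Properties using (anySubset?)
open import Data.Product using (Σ; _,_; proj₁; ∃)
open import Data.Sum using (_⊎_; inj₁; inj₂)
open import Data.Empty using (⊥-elim)
open import Function using (_∘_)
open import Relation.Nullary using (¬_; yes; no)
open import Relation.Nullary.Decidable using (decidable-stable)
open import Relation.Unary using (Pred; Decidable)
open import Relation.Binary.PropositionalEquality using (_≡_; refl; subst)

¬∀⇒∃¬-Part : ∀ {d ℓ p} {P : Pred (Part d ℓ) p} → Decidable P →
  ¬ (∀ I → P I) → ∃ λ I → ¬ P I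
¬∀⇒∃¬-Part {d} {ℓ} {P = P} P? ¬∀P with anySubset? counterexample?
  where
  Counterexample : Pred (Subset d) _
  Counterexample I = Σ (∣ I ∣ ≡ ℓ) λ q → ¬ P (I , q)

  counterexample? : Decidable Counterexample
  counterexample? I with ∣ I ∣ ≟ℕ ℓ
  ... | no ∣I∣≢ℓ = no (∣I∣≢ℓ ∘ proj₁)
  ... | yes q with P? (I , q)
  ...   | no ¬P = yes (q , ¬P)
  ...   | yes Pq = no λ { (q′ , ¬P) → ¬P (subst (λ r → P (I , r)) (≡-irrelevant q q′) Pq) }
... | yes (I , q , ¬P) = (I , q) , ¬P
... | no ¬∃ = ⊥-elim (¬∀P λ { (I , q) → decidable-stable (P? (I , q)) λ ¬P → ¬∃ (I , q , ¬P) })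

module _ {d ℓ : ℕ} (G : Hypergraph d ℓ) where
  open Hypergraph G

  _∷ʳ_ : {u v w : Vertex} → Path u v → Adj v w → Path u w
  [ v ] ∷ʳ a = a ∷ [ _ ]
  (b ∷ p) ∷ʳ a = b ∷ (p ∷ʳ a)

  Hits-∷ʳ : ∀ j {u v w : Vertex} (p : Path u v) (a : Adj v w) →
    Hits j (p ∷ʳ a) → Hits j p ⊎ j ∈ proj₁ (proj₁ w)
  Hits-∷ʳ j [ v ] a h = h
  Hits-∷ʳ j (b ∷ p) a (inj₁ h) = inj₁ (inj₁ h)
  Hits-∷ʳ j (b ∷ p) a (inj₂ h) with Hits-∷ʳ j p a h
  ... | inj₁ h′ = inj₁ (inj₂ h′)
  ... | inj₂ h′ = inj₂ h′

  edgesSeparable-by-part : ∀ {e e′} → E e → E e′ → ∀ I →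
    VerticesSeparable I (e I) (e′ I) → EdgesSeparable e e′
  edgesSeparable-by-part {e} {e′} Ee Ee′ I (j , j∉I , sep) = j , avoids
    where
    avoids : ∀ v v′ → v ∈ₑ e → v′ ∈ₑ e′ → (p : Path v v′) → Hits j p
    avoids v v′ v∈e v′∈e′ p
      with sep ((e , Ee , refl , v∈e) ∷ (p ∷ʳ (e′ , Ee′ , v′∈e′ , refl)))
    ... | inj₁ j∈I = ⊥-elim (j∉I j∈I)
    ... | inj₂ h with Hits-∷ʳ j p (e′ , Ee′ , v′∈e′ , refl) h
    ...   | inj₁ hits = hits
    ...   | inj₂ j∈I = ⊥-elim (j∉I j∈I)

lemma9 : (d ℓ : ℕ) → 2 ≤ d → 1 ≤ ℓ → ℓ ≤ d ∸ 1 → (G : Hypergraph d ℓ) →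
    Hypergraph.VertexSeparable G → Hypergraph.EdgeSeparable G
lemma9 d ℓ _ _ _ G vertexSeparable e e′ Ee Ee′ e≢e′ =
  let I , eI≢e′I = ¬∀⇒∃¬-Part (λ I → e I ≟ e′ I) e≢e′
  in edgesSeparable-by-part G Ee Ee′ I (vertexSeparable I (e I) (e′ I) eI≢e′I)
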